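{- Let $\mu$ be a partition and let $x\in K_\mu$ with $|S(x)|=w(\mu)$. Then $\lambda_x=\mu_x$.
   Context: Partitions are finite non-increasing sequences of non-negative integers, identified up to trailing zeros; $l(\lambda)$ is the number of nonzero parts, $|\lambda|$ the sum of parts, and $w(\lambda)=l(\lambda)+|\lambda|$. $S_{2\infty}$ is the group of finitely supported permutations of the positive integers and $S(x)=\{i:x(i)\neq i\}$. The stable cycle type $\lambda_x$ of $x$ is the partition obtained from the cycle type of $x$ by subtracting $1$ from every part (and discarding zeros). For $x\in S_{2n}$ define the graph $\Gamma_x$: vertices $v_i=(i,x(i))$, $i\in[2n]$; straight edges $(v_{2i-1}:v_{2i})$ and curved edges $(v_{x^{ -1}(2i-1)}:v_{x^{ -1}(2i)})$, $i=1,\dots,n$. Its connected components have sizes $2s_1\ge\dots\ge 2s_k$; the stable coset type $\mu_x$ is the partition with parts $s_1-1,\dots,s_k-1$ (zeros discarded), which does not depend on the $n$ with $x\in S_{2n}$. $K_\mu=\{x\in S_{2\infty}:\mu_x=\mu\}$. -}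

module Defs where

open import Data.Nat using (ℕ; zero; suc; _+_; _*_; _∸_; _≤ᵇ_; _≡ᵇ_; _/_; _<_; _≥_)
open import Data.Bool using (Bool; true; false; _∧_; _∨_; not; if_then_else_)
open import Data.List using (List; []; _∷_; length; map; allFin; upTo)
open import Data.Nat.ListAction using (sum)
open import Data.Bool.ListAction using (any; all)
open import Data.List.Relation.Unary.Linked using (Linked)
open import Data.List.Relation.Unary.All using (All)
open import Data.Product using (_×_)
open import Data.Fin using (Fin; toℕ)
open import Data.Fin.Permutation using (Permutation′; _⟨$⟩ʳ_)

-- Partitions: lists of positive naturals in non-increasing order
-- (a partition is identified up to trailing zeros, so zeros are never stored).

IsPartition : List ℕ → Set
IsPartition p = Linked _≥_ p × All (λ k → 0 < k) p

w : List ℕ → ℕ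
w p = length p + sum p

insertDesc : ℕ → List ℕ → List ℕ
insertDesc a [] = a ∷ []
insertDesc a (b ∷ bs) = if b ≤ᵇ a then a ∷ b ∷ bs else b ∷ insertDesc a bs

sortDesc : List ℕ → List ℕ
sortDesc [] = []
sortDesc (a ∷ as) = insertDesc a (sortDesc as)

dropZeros : List ℕ → List ℕ
dropZeros [] = []
dropZeros (zero ∷ as) = dropZeros as
dropZeros (suc a ∷ as) = suc a ∷ dropZeros as

toPartition : List ℕ → List ℕ
toPartition xs = sortDesc (dropZeros xs)

-- Generic finite helpers on Fin m (Fin index t stands for the integer t+1)

_==_ : ∀ {m} → Fin m → Fin m → Bool
i == j = toℕ i ≡ᵇ toℕ j

_≤F_ : ∀ {m} → Fin m → Fin m → Bool
i ≤F j = toℕ i ≤ᵇ toℕ j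

countF : ∀ {m} → (Fin m → Bool) → ℕ
countF {m} P = length (Data.List.filterᵇ P (allFin m))

anyF : ∀ {m} → (Fin m → Bool) → Bool
anyF {m} P = any P (allFin m)

allF : ∀ {m} → (Fin m → Bool) → Bool
allF {m} P = all P (allFin m)

S2 : ℕ → Set
S2 n = Permutation′ (2 * n)

module _ (n : ℕ) (x : S2 n) where

  private
    m = 2 * n
    ap : Fin m → Fin m
    ap i = x ⟨$⟩ʳ i

  supportSize : ℕ
  supportSize = countF (λ i → not (ap i == i))

  iter : ℕ → Fin m → Fin m
  iter zero i = i
  iter (suc k) i = ap (iter k i)

  inOrbit : Fin m → Fin m → Bool
  inOrbit i j = any (λ k → iter k i == j) (upTo m)

  orbitRep : Fin m → Bool
  orbitRep i = allF (λ j → not (inOrbit i j) ∨ (i ≤F j))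

  cycleLengths : List ℕ
  cycleLengths = map (λ i → countF (inOrbit i)) (Data.List.filterᵇ orbitRep (allFin m))

  stableCycleType : List ℕ
  stableCycleType = toPartition (map (λ c → c ∸ 1) cycleLengths)

  -- The graph Γ_x on vertices v_i (i ∈ [2n]).
  -- Straight edge (v_{2i-1} : v_{2i}); in 0-based indices: vertices a ≠ b with ⌊a/2⌋ = ⌊b/2⌋.
  straight : Fin m → Fin m → Bool
  straight a b = not (a == b) ∧ ((toℕ a / 2) ≡ᵇ (toℕ b / 2))

  -- Curved edge (v_{x⁻¹(2i-1)} : v_{x⁻¹(2i)}): vertices a ≠ b with {x(a),x(b)} = {2i-1,2i}.
  curved : Fin m → Fin m → Bool
  curved a b = not (a == b) ∧ ((toℕ (ap a) / 2) ≡ᵇ (toℕ (ap b) / 2))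

  adj : Fin m → Fin m → Bool
  adj a b = straight a b ∨ curved a b

  reachIn : ℕ → Fin m → Fin m → Bool
  reachIn zero a b = a == b
  reachIn (suc t) a b = reachIn t a b ∨ anyF (λ c → reachIn t a c ∧ adj c b)

  -- connected in Γ_x (walks of length ≤ 2n suffice in a graph with 2n vertices)
  connected : Fin m → Fin m → Bool
  connected a b = reachIn m a b

  componentRep : Fin m → Bool
  componentRep a = allF (λ b → not (connected a b) ∨ (a ≤F b))

  -- sizes 2s_1, …, 2s_k of the connected components
  componentSizes : List ℕ
  componentSizes = map (λ a → countF (connected a)) (Data.List.filterᵇ componentRep (allFin m))

  -- stable coset type μ_x : parts s_j - 1
  stableCosetType : List ℕ
  stableCosetType = toPartition (map (λ c → (c / 2) ∸ 1) componentSizes)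

-- Write m = 2n, let p be the partner involution of Fin m (p swaps 2i and
-- 2i+1, so the straight edges of Γ_x are a — p a), let C(a) be the
-- component of a in Γ_x and O(a) the cycle of x through a.
--
--  1. Each component of Γ_x is closed under p, so has even size 2s, and it
--     contributes 2(s - 1) + 2 = 2·wPart(s - 1) to 2·w(μ_x) when s ≥ 2.  Summing
--     over vertices, Σ_a [|C(a)| ≥ 4] = 2·w(μ_x).
--  2. If a and p a are both fixed by x then C(a) ⊆ {a, p a}; hence
--     [|C(a)| ≥ 4] ≤ [a moved] + [p a moved], and the right-hand side sums
--     to 2·|S(x)| = 2·w(μ).  So equality holds for every vertex: at most one
--     point of each straight pair is moved, and moved points lie in big
--     components.
--  3. For a moved, p(x a) is fixed, so a — p(x a) — x a is a path in Γ_x;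
--     thus O(a) ⊆ C(a), and conversely the moved vertices of C(a) form
--     O(a).  Consequently |C(a)|/2 - 1 = (|O(a)| - 1) + (|O(p a)| - 1) with
--     at most one non-zero summand.
--  4. Double counting over classes turns this vertexwise identity into
--     equal multiplicities of every positive part of λ_x and μ_x; two sorted
--     lists with the same multiplicities coincide.
module Submission where

open import Defs
open import Data.Bool using (Bool; true; false; _∧_; _∨_; not; T)
open import Data.Empty using (⊥; ⊥-elim)
open import Data.Fin using (Fin; zero; suc; toℕ)
open import Data.Fin.Permutation using (_⟨$⟩ʳ_; _⟨$⟩ˡ_; inverseˡ; permutation)
open import Data.Fin.Properties using (toℕ-injective; toℕ<n; pigeonhole) renaming (suc-injective to Fin-suc-injective)
open import Data.List using (List; []; _∷_; length; map; allFin; filterᵇ; tabulate; upTo)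
open import Data.List.Properties using (length-filter; length-tabulate; map-∘)
open import Data.Bool.Properties using (T?)
open import Data.List.Membership.Propositional using (_∈_)
open import Data.List.Membership.Propositional.Properties using (∈-allFin; ∈-upTo⁺)
open import Data.List.Relation.Unary.All using (All; []; _∷_)
open import Data.List.Relation.Unary.Any using (here; there)
open import Data.List.Relation.Unary.AllPairs using (AllPairs; []; _∷_)
open import Data.Bool.ListAction using (any; all)
import Data.Nat.ListAction as List
open import Data.Nat using (ℕ; zero; suc; _+_; _*_; _∸_; _≤_; _<_; _≥_; z≤n; s≤s; _≡ᵇ_; _≤ᵇ_; _/_; _%_)
open import Data.Nat.Properties
open import Data.Nat.DivMod using (m≡m%n+[m/n]*n; m%n<n; m*n/n≡m; m/n≡1+[m∸n]/n)
open import Data.Product using (_×_; _,_; proj₁; proj₂; Σ; ∃)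
open import Data.Sum using (_⊎_; inj₁; inj₂)
open import Relation.Binary.PropositionalEquality
open import Function using (_∘′_)
open import Algebra.Properties.Semiring.Sum +-*-semiring
  using (sum; sum-cong-≗; ∑-distrib-+; ∑-comm; sum-permute; *-distribˡ-sum)
open import Algebra.Properties.CommutativeSemigroup +-commutativeSemigroup
  using () renaming (x∙yz≈y∙xz to +-exchange)
open import Algebra.Properties.CommutativeSemigroup *-commutativeSemigroup
  using () renaming (x∙yz≈y∙xz to *-exchange)

⟦_⟧ : Bool → ℕ
⟦ true ⟧ = 1
⟦ false ⟧ = 0

⟦⟧≤1 : ∀ b → ⟦ b ⟧ ≤ 1
⟦⟧≤1 true = ≤-refl
⟦⟧≤1 false = z≤n

⟦true⟧ : ∀ {b} → b ≡ true → ⟦ b ⟧ ≡ 1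
⟦true⟧ refl = refl

⟦false⟧ : ∀ {b} → b ≡ false → ⟦ b ⟧ ≡ 0
⟦false⟧ refl = refl

⟦∧⟧ : ∀ b c → ⟦ b ∧ c ⟧ ≡ ⟦ b ⟧ * ⟦ c ⟧
⟦∧⟧ true c = sym (+-identityʳ ⟦ c ⟧)
⟦∧⟧ false c = refl

⟦⟧-false : ∀ {b} → ⟦ b ⟧ ≡ 0 → b ≡ false
⟦⟧-false {false} _ = refl

true≢false : ∀ {b} → b ≡ true → b ≡ false → ⊥
true≢false refl ()

bool-case : ∀ b → b ≡ true ⊎ b ≡ false
bool-case true = inj₁ refl
bool-case false = inj₂ refl

not-true : ∀ {b} → not b ≡ true → b ≡ false
not-true {false} _ = refl

bool-ext : ∀ {b c : Bool} → (b ≡ true → c ≡ true) → (c ≡ true → b ≡ true) → b ≡ c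
bool-ext {true} f g = sym (f refl)
bool-ext {false} {true} f g = g refl
bool-ext {false} {false} f g = refl

∧-intro : ∀ {b c} → b ≡ true → c ≡ true → b ∧ c ≡ true
∧-intro refl refl = refl

∧-elimˡ : ∀ {b c} → b ∧ c ≡ true → b ≡ true
∧-elimˡ {true} _ = refl

∧-elimʳ : ∀ {b c} → b ∧ c ≡ true → c ≡ true
∧-elimʳ {true} e = e

∨-introˡ : ∀ {b} c → b ≡ true → b ∨ c ≡ true
∨-introˡ c refl = refl

∨-introʳ : ∀ b {c} → c ≡ true → b ∨ c ≡ true
∨-introʳ true _ = refl
∨-introʳ false e = e

∨-elim : ∀ {b c} → b ∨ c ≡ true → b ≡ true ⊎ c ≡ true
∨-elim {true} _ = inj₁ refl
∨-elim {false} e = inj₂ e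

T⇒true : ∀ {b} → T b → b ≡ true
T⇒true {true} _ = refl

true⇒T : ∀ {b} → b ≡ true → T b
true⇒T refl = _

==⇒≡ : ∀ {m} {i j : Fin m} → i == j ≡ true → i ≡ j
==⇒≡ {i = i} {j} e = toℕ-injective (≡ᵇ⇒≡ (toℕ i) (toℕ j) (true⇒T e))

≡⇒== : ∀ {m} {i j : Fin m} → i ≡ j → i == j ≡ true
≡⇒== {i = i} refl = T⇒true (≡⇒≡ᵇ (toℕ i) (toℕ i) refl)

≢⇒== : ∀ {m} {i j : Fin m} → (i ≡ j → ⊥) → i == j ≡ false
≢⇒== {i = i} {j} ne with i == j in eq
... | true = ⊥-elim (ne (==⇒≡ eq))
... | false = refl

≤F⇒≤ : ∀ {m} {i j : Fin m} → i ≤F j ≡ true → toℕ i ≤ toℕ j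
≤F⇒≤ {i = i} {j} e = ≤ᵇ⇒≤ (toℕ i) (toℕ j) (true⇒T e)

≤⇒≤F : ∀ {m} {i j : Fin m} → toℕ i ≤ toℕ j → i ≤F j ≡ true
≤⇒≤F le = T⇒true (≤⇒≤ᵇ le)

≤ᵇ-false : ∀ {a b} → b < a → (a ≤ᵇ b) ≡ false
≤ᵇ-false {a} {b} b<a with bool-case (a ≤ᵇ b)
... | inj₂ f = f
... | inj₁ t = ⊥-elim (<⇒≱ b<a (≤ᵇ⇒≤ a b (true⇒T t)))

any⁺ : ∀ {A : Set} (P : A → Bool) {l : List A} {a : A} → a ∈ l → P a ≡ true → any P l ≡ true
any⁺ P (here refl) pa = ∨-introˡ _ pa
any⁺ P {b ∷ _} (there a∈l) pa = ∨-introʳ (P b) (any⁺ P a∈l pa)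

any⁻ : ∀ {A : Set} (P : A → Bool) (l : List A) → any P l ≡ true → ∃ λ a → P a ≡ true
any⁻ P (a ∷ l) e with ∨-elim {P a} e
... | inj₁ pa = a , pa
... | inj₂ rest = any⁻ P l rest

all⁺ : ∀ {A : Set} (P : A → Bool) (l : List A) → (∀ a → P a ≡ true) → all P l ≡ true
all⁺ P [] h = refl
all⁺ P (a ∷ l) h = ∧-intro (h a) (all⁺ P l h)

all⁻ : ∀ {A : Set} (P : A → Bool) {l : List A} {a : A} → all P l ≡ true → a ∈ l → P a ≡ true
all⁻ P e (here refl) = ∧-elimˡ e
all⁻ P {b ∷ _} e (there a∈l) = all⁻ P (∧-elimʳ {P b} e) a∈l

anyF⁺ : ∀ {m} {P : Fin m → Bool} (i : Fin m) → P i ≡ true → anyF P ≡ true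
anyF⁺ {P = P} i = any⁺ P (∈-allFin i)

anyF⁻ : ∀ {m} {P : Fin m → Bool} → anyF P ≡ true → ∃ λ i → P i ≡ true
anyF⁻ {m} {P} = any⁻ P (allFin m)

allF⁺ : ∀ {m} {P : Fin m → Bool} → (∀ i → P i ≡ true) → allF P ≡ true
allF⁺ {m} {P} = all⁺ P (allFin m)

allF⁻ : ∀ {m} {P : Fin m → Bool} → allF P ≡ true → ∀ i → P i ≡ true
allF⁻ {P = P} e i = all⁻ P e (∈-allFin i)

sum-mono : ∀ {m} {f g : Fin m → ℕ} → (∀ i → f i ≤ g i) → sum f ≤ sum g
sum-mono {zero} le = z≤n
sum-mono {suc m} le = +-mono-≤ (le zero) (sum-mono (λ i → le (suc i)))

sum-mono-< : ∀ {m} {f g : Fin m → ℕ} → (∀ i → f i ≤ g i) → (j : Fin m) → f j < g j → sum f < sum g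
sum-mono-< {suc m} le zero lt = +-mono-<-≤ lt (sum-mono (λ i → le (suc i)))
sum-mono-< {suc m} le (suc j) lt = +-mono-≤-< (le zero) (sum-mono-< (λ i → le (suc i)) j lt)

sum-≤-≡ : ∀ {m} {f g : Fin m → ℕ} → (∀ i → f i ≤ g i) → sum f ≡ sum g → ∀ i → f i ≡ g i
sum-≤-≡ le e i with m≤n⇒m<n∨m≡n (le i)
... | inj₂ fi≡gi = fi≡gi
... | inj₁ fi<gi = ⊥-elim (<⇒≢ (sum-mono-< le i fi<gi) e)

sum-zero : ∀ {m} {f : Fin m → ℕ} → (∀ i → f i ≡ 0) → sum f ≡ 0
sum-zero {zero} e = refl
sum-zero {suc m} e = cong₂ _+_ (e zero) (sum-zero (λ i → e (suc i)))

sum-delta : ∀ {m} (r : Fin m) → sum (λ i → ⟦ i == r ⟧) ≡ 1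
sum-delta {suc m} zero = cong suc (sum-zero {f = λ i → ⟦ suc i == zero {m} ⟧} (λ i → refl))
sum-delta {suc m} (suc r) = sum-delta r

sum-*ˡ : ∀ {m} (c : ℕ) (f : Fin m → ℕ) → sum (λ i → c * f i) ≡ c * sum f
sum-*ˡ c f = sym (*-distribˡ-sum c f)

sum-involution : ∀ {m} (p : Fin m → Fin m) (p-inv : ∀ a → p (p a) ≡ a) (F G : Fin m → ℕ) →
  (∀ a → F a ≡ G a + G (p a)) → sum F ≡ 2 * sum G
sum-involution p p-inv F G split = begin
  sum F                          ≡⟨ sum-cong-≗ split ⟩
  sum (λ a → G a + G (p a))      ≡⟨ ∑-distrib-+ G (λ a → G (p a)) ⟩
  sum G + sum (λ a → G (p a))    ≡⟨ cong (sum G +_) (sym (sum-permute G (permutation p p p-inv p-inv))) ⟩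
  sum G + sum G                  ≡⟨ cong (sum G +_) (sym (+-identityʳ (sum G))) ⟩
  2 * sum G                      ∎
  where open ≡-Reasoning

countF-sum : ∀ {m} (P : Fin m → Bool) → countF P ≡ sum (λ i → ⟦ P i ⟧)
countF-sum {m} P = count-tabulate (λ i → i)
  where
  count-tabulate : ∀ {k} (f : Fin k → Fin m) → length (filterᵇ P (tabulate f)) ≡ sum (λ i → ⟦ P (f i) ⟧)
  count-tabulate {zero} f = refl
  count-tabulate {suc k} f with P (f zero)
  ... | true = cong suc (count-tabulate (λ i → f (suc i)))
  ... | false = count-tabulate (λ i → f (suc i))

countF≤ : ∀ {m} (P : Fin m → Bool) → countF P ≤ m
countF≤ {m} P = ≤-trans (length-filter (λ i → T? (P i)) (allFin m))
                        (≤-reflexive (length-tabulate (λ i → i)))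

countF-pos : ∀ {m} (P : Fin m → Bool) (i : Fin m) → P i ≡ true → 1 ≤ countF P
countF-pos {m} P i e = begin-strict
  0                        ≡⟨ sym (sum-zero {m} {λ _ → 0} (λ _ → refl)) ⟩
  sum {m} (λ _ → 0)        <⟨ sum-mono-< (λ _ → z≤n) i (≤-reflexive (sym (⟦true⟧ e))) ⟩
  sum (λ j → ⟦ P j ⟧)      ≡⟨ sym (countF-sum P) ⟩
  countF P                 ∎
  where open ≤-Reasoning

countF-mono-< : ∀ {m} {P Q : Fin m → Bool} → (∀ {i} → P i ≡ true → Q i ≡ true) →
  (j : Fin m) → Q j ≡ true → P j ≡ false → countF P < countF Q
countF-mono-< {P = P} {Q} P⊆Q j qj pj = subst₂ _<_ (sym (countF-sum P)) (sym (countF-sum Q))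
  (sum-mono-< included j (subst₂ _<_ (sym (⟦false⟧ pj)) (sym (⟦true⟧ qj)) (s≤s z≤n)))
  where
  included : ∀ i → ⟦ P i ⟧ ≤ ⟦ Q i ⟧
  included i with P i in pi
  ... | false = z≤n
  ... | true rewrite P⊆Q pi = ≤-refl

-- Partitions: multiplicities and weight

mult : ℕ → List ℕ → ℕ
mult k l = List.sum (map (λ e → ⟦ e ≡ᵇ k ⟧) l)

Sorted≥ : List ℕ → Set
Sorted≥ = AllPairs _≥_

insertDesc-All : ∀ {P : ℕ → Set} a l → P a → All P l → All P (insertDesc a l)
insertDesc-All a [] pa _ = pa ∷ []
insertDesc-All a (b ∷ bs) pa (pb ∷ pbs) with b ≤ᵇ a
... | true = pa ∷ pb ∷ pbs
... | false = pb ∷ insertDesc-All a bs pa pbs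

sortDesc-All : ∀ {P : ℕ → Set} l → All P l → All P (sortDesc l)
sortDesc-All [] [] = []
sortDesc-All (a ∷ l) (pa ∷ pl) = insertDesc-All a (sortDesc l) pa (sortDesc-All l pl)

insertDesc-sorted : ∀ a l → Sorted≥ l → Sorted≥ (insertDesc a l)
insertDesc-sorted a [] [] = [] ∷ []
insertDesc-sorted a (b ∷ bs) (b≥bs ∷ sbs) with b ≤ᵇ a in eq
... | true = (b≤a ∷ Data.List.Relation.Unary.All.map (λ c≤b → ≤-trans c≤b b≤a) b≥bs) ∷ b≥bs ∷ sbs
  where
  b≤a : b ≤ a
  b≤a = ≤ᵇ⇒≤ b a (true⇒T eq)
... | false = insertDesc-All a bs a≤b b≥bs ∷ insertDesc-sorted a bs sbs
  where
  a≤b : a ≤ b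
  a≤b = <⇒≤ (≰⇒> (λ b≤a → true≢false (T⇒true (≤⇒≤ᵇ b≤a)) eq))

sortDesc-sorted : ∀ l → Sorted≥ (sortDesc l)
sortDesc-sorted [] = []
sortDesc-sorted (a ∷ l) = insertDesc-sorted a (sortDesc l) (sortDesc-sorted l)

mult-insertDesc : ∀ k a l → mult k (insertDesc a l) ≡ ⟦ a ≡ᵇ k ⟧ + mult k l
mult-insertDesc k a [] = refl
mult-insertDesc k a (b ∷ bs) with b ≤ᵇ a
... | true = refl
... | false = trans (cong (⟦ b ≡ᵇ k ⟧ +_) (mult-insertDesc k a bs)) (+-exchange ⟦ b ≡ᵇ k ⟧ ⟦ a ≡ᵇ k ⟧ _)

mult-sortDesc : ∀ k l → mult k (sortDesc l) ≡ mult k l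
mult-sortDesc k [] = refl
mult-sortDesc k (a ∷ l) = trans (mult-insertDesc k a (sortDesc l)) (cong (⟦ a ≡ᵇ k ⟧ +_) (mult-sortDesc k l))

mult-dropZeros : ∀ k l → mult (suc k) (dropZeros l) ≡ mult (suc k) l
mult-dropZeros k [] = refl
mult-dropZeros k (zero ∷ l) = mult-dropZeros k l
mult-dropZeros k (suc a ∷ l) = cong (⟦ a ≡ᵇ k ⟧ +_) (mult-dropZeros k l)

dropZeros-positive : ∀ l → All (0 <_) (dropZeros l)
dropZeros-positive [] = []
dropZeros-positive (zero ∷ l) = dropZeros-positive l
dropZeros-positive (suc a ∷ l) = s≤s z≤n ∷ dropZeros-positive l

mult-zero : ∀ l → All (0 <_) l → mult 0 l ≡ 0
mult-zero [] [] = refl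
mult-zero (suc a ∷ l) (_ ∷ pl) = mult-zero l pl

mult-toPartition : ∀ k l → mult (suc k) (toPartition l) ≡ mult (suc k) l
mult-toPartition k l = trans (mult-sortDesc (suc k) (dropZeros l)) (mult-dropZeros k l)

mult-toPartition-zero : ∀ l → mult 0 (toPartition l) ≡ 0
mult-toPartition-zero l = mult-zero _ (sortDesc-All _ (dropZeros-positive l))

≡ᵇ-refl : ∀ k → (k ≡ᵇ k) ≡ true
≡ᵇ-refl k = T⇒true (≡⇒≡ᵇ k k refl)

mult-head : ∀ x xs → 0 < mult x (x ∷ xs)
mult-head x xs rewrite ≡ᵇ-refl x = s≤s z≤n

mult-≤-head : ∀ {k y ys} → Sorted≥ (y ∷ ys) → 0 < mult k (y ∷ ys) → k ≤ y
mult-≤-head {k} {y} {ys} (y≥ys ∷ _) pos with y ≡ᵇ k in eq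
... | true = ≤-reflexive (sym (≡ᵇ⇒≡ y k (true⇒T eq)))
... | false = occurs y≥ys pos
  where
  occurs : ∀ {zs} → All (_≤ y) zs → 0 < mult k zs → k ≤ y
  occurs {z ∷ zs} (z≤y ∷ zs≤y) pos′ with z ≡ᵇ k in eqz
  ... | true = subst (_≤ y) (≡ᵇ⇒≡ z k (true⇒T eqz)) z≤y
  ... | false = occurs zs≤y pos′

sorted-unique : ∀ xs ys → Sorted≥ xs → Sorted≥ ys → (∀ k → mult k xs ≡ mult k ys) → xs ≡ ys
sorted-unique [] [] _ _ _ = refl
sorted-unique [] (y ∷ ys) _ _ e = ⊥-elim (<⇒≢ (mult-head y ys) (e y))
sorted-unique (x ∷ xs) [] _ _ e = ⊥-elim (<⇒≢ (mult-head x xs) (sym (e x)))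
sorted-unique (x ∷ xs) (y ∷ ys) sx@(_ ∷ sxs) sy@(_ ∷ sys) e =
  cong₂ _∷_ x≡y (sorted-unique xs ys sxs sys tails)
  where
  x≡y : x ≡ y
  x≡y = ≤-antisym (mult-≤-head sy (subst (0 <_) (e x) (mult-head x xs)))
                  (mult-≤-head sx (subst (0 <_) (sym (e y)) (mult-head y ys)))
  tails : ∀ k → mult k xs ≡ mult k ys
  tails k = +-cancelˡ-≡ ⟦ x ≡ᵇ k ⟧ _ _ (trans (e k) (cong (λ z → ⟦ z ≡ᵇ k ⟧ + mult k ys) (sym x≡y)))

toPartition-ext : ∀ xs ys → (∀ k → mult (suc k) xs ≡ mult (suc k) ys) → toPartition xs ≡ toPartition ys
toPartition-ext xs ys e = sorted-unique _ _ (sortDesc-sorted (dropZeros xs)) (sortDesc-sorted (dropZeros ys)) same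
  where
  same : ∀ k → mult k (toPartition xs) ≡ mult k (toPartition ys)
  same zero = trans (mult-toPartition-zero xs) (sym (mult-toPartition-zero ys))
  same (suc k) = trans (mult-toPartition k xs) (trans (e k) (sym (mult-toPartition k ys)))

-- Contribution of a part e to the weight w: l(λ) + |λ| gains e + 1 when e > 0.
wPart : ℕ → ℕ
wPart zero = 0
wPart (suc e) = suc (suc e)

w-cons : ∀ a l → w (a ∷ l) ≡ suc a + w l
w-cons a l = cong suc (begin
  length l + (a + List.sum l)  ≡⟨ sym (+-assoc (length l) a _) ⟩
  length l + a + List.sum l    ≡⟨ cong (_+ List.sum l) (+-comm (length l) a) ⟩
  a + length l + List.sum l    ≡⟨ +-assoc a (length l) _ ⟩
  a + w l                      ∎)
  where open ≡-Reasoning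

w-insertDesc : ∀ a l → w (insertDesc a l) ≡ suc a + w l
w-insertDesc a [] = w-cons a []
w-insertDesc a (b ∷ bs) with b ≤ᵇ a
... | true = w-cons a (b ∷ bs)
... | false = begin
  w (b ∷ insertDesc a bs)     ≡⟨ w-cons b (insertDesc a bs) ⟩
  suc b + w (insertDesc a bs) ≡⟨ cong (suc b +_) (w-insertDesc a bs) ⟩
  suc b + (suc a + w bs)      ≡⟨ +-exchange (suc b) (suc a) (w bs) ⟩
  suc a + (suc b + w bs)      ≡⟨ cong (suc a +_) (sym (w-cons b bs)) ⟩
  suc a + w (b ∷ bs)          ∎
  where open ≡-Reasoning

w-sortDesc : ∀ l → w (sortDesc l) ≡ List.sum (map suc l)
w-sortDesc [] = refl
w-sortDesc (a ∷ l) = trans (w-insertDesc a (sortDesc l)) (cong (suc a +_) (w-sortDesc l))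

w-toPartition : ∀ l → w (toPartition l) ≡ List.sum (map wPart l)
w-toPartition l = trans (w-sortDesc (dropZeros l)) (dropped l)
  where
  dropped : ∀ l → List.sum (map suc (dropZeros l)) ≡ List.sum (map wPart l)
  dropped [] = refl
  dropped (zero ∷ l) = dropped l
  dropped (suc a ∷ l) = cong (suc (suc a) +_) (dropped l)

-- Classes of a decidable equivalence on Fin m

least-witness : ∀ {m} (P : Fin m → Bool) (a : Fin m) → P a ≡ true →
  Σ (Fin m) λ r → P r ≡ true × (∀ b → P b ≡ true → toℕ r ≤ toℕ b)
least-witness {suc m} P a pa with P zero in p0
... | true = zero , p0 , λ _ _ → z≤n
least-witness {suc m} P zero pa | false = ⊥-elim (true≢false pa p0)
least-witness {suc m} P (suc a) pa | false with least-witness (λ i → P (suc i)) a pa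
... | r , pr , r-least = suc r , pr , below
  where
  below : ∀ b → P b ≡ true → toℕ (suc r) ≤ toℕ b
  below zero pb = ⊥-elim (true≢false pb p0)
  below (suc b) pb = s≤s (r-least b pb)

-- Cycles of x and components of Γ_x are both listed in Defs as the classes
-- of an equivalence, represented by their least elements; this module
-- relates sums over classes to sums over elements.
module Classes {m : ℕ} (E : Fin m → Fin m → Bool)
  (E-refl : ∀ a → E a a ≡ true)
  (E-sym : ∀ {a b} → E a b ≡ true → E b a ≡ true)
  (E-trans : ∀ {a b c} → E a b ≡ true → E b c ≡ true → E a c ≡ true) where

  size : Fin m → ℕ
  size a = countF (E a)

  isLeast : Fin m → Bool
  isLeast r = allF (λ b → not (E r b) ∨ (r ≤F b))

  classSizes : List ℕ
  classSizes = map size (filterᵇ isLeast (allFin m))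

  same-class : ∀ {a r} → E r a ≡ true → ∀ b → E a b ≡ E r b
  same-class ra b = bool-ext (E-trans ra) (E-trans (E-sym ra))

  size-cong : ∀ {a r} → E r a ≡ true → size a ≡ size r
  size-cong {a} {r} ra = begin
    countF (E a)            ≡⟨ countF-sum (E a) ⟩
    sum (λ b → ⟦ E a b ⟧)   ≡⟨ sum-cong-≗ (λ b → cong ⟦_⟧ (same-class ra b)) ⟩
    sum (λ b → ⟦ E r b ⟧)   ≡⟨ sym (countF-sum (E r)) ⟩
    countF (E r)            ∎
    where open ≡-Reasoning

  isLeast-≤ : ∀ {r b} → isLeast r ≡ true → E r b ≡ true → toℕ r ≤ toℕ b
  isLeast-≤ {r} {b} least rb with ∨-elim {not (E r b)} (allF⁻ least b)
  ... | inj₁ r≁b = ⊥-elim (true≢false rb (not-true r≁b))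
  ... | inj₂ r≤b = ≤F⇒≤ r≤b

  one-least : ∀ a → sum (λ r → ⟦ isLeast r ⟧ * ⟦ E r a ⟧) ≡ 1
  one-least a = trans (sum-cong-≗ is-r₀) (sum-delta r₀)
    where
    r₀ : Fin m
    r₀ = proj₁ (least-witness (λ r → E r a) a (E-refl a))
    r₀a : E r₀ a ≡ true
    r₀a = proj₁ (proj₂ (least-witness (λ r → E r a) a (E-refl a)))
    r₀-least : ∀ b → E b a ≡ true → toℕ r₀ ≤ toℕ b
    r₀-least = proj₂ (proj₂ (least-witness (λ r → E r a) a (E-refl a)))
    isLeast-r₀ : isLeast r₀ ≡ true
    isLeast-r₀ = allF⁺ below
      where
      below : ∀ b → not (E r₀ b) ∨ (r₀ ≤F b) ≡ true
      below b with E r₀ b in r₀b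
      ... | true = ≤⇒≤F (r₀-least b (E-trans (E-sym r₀b) r₀a))
      ... | false = refl
    is-r₀ : ∀ r → ⟦ isLeast r ⟧ * ⟦ E r a ⟧ ≡ ⟦ r == r₀ ⟧
    is-r₀ r with isLeast r in lr | E r a in ra
    ... | true | true = sym (⟦true⟧ (≡⇒== (toℕ-injective
                          (≤-antisym (isLeast-≤ lr (E-trans ra (E-sym r₀a))) (r₀-least r ra)))))
    ... | true | false = sym (⟦false⟧ (≢⇒== {i = r} {r₀} λ { refl → true≢false r₀a ra }))
    ... | false | _ = trans (*-zeroˡ ⟦ E r a ⟧) (sym (⟦false⟧ (≢⇒== {i = r} {r₀} λ { refl → true≢false isLeast-r₀ lr })))

  sum-classSizes : (F : ℕ → ℕ) → List.sum (map F classSizes) ≡ sum (λ r → ⟦ isLeast r ⟧ * F (size r))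
  sum-classSizes F = trans (cong List.sum (sym (map-∘ (filterᵇ isLeast (allFin m))))) (sum-tabulate (λ i → i))
    where
    sum-tabulate : ∀ {k} (f : Fin k → Fin m) →
      List.sum (map (F ∘′ size) (filterᵇ isLeast (tabulate f))) ≡ sum (λ i → ⟦ isLeast (f i) ⟧ * F (size (f i)))
    sum-tabulate {zero} f = refl
    sum-tabulate {suc k} f with isLeast (f zero)
    ... | true = cong₂ _+_ (sym (+-identityʳ _)) (sum-tabulate (λ i → f (suc i)))
    ... | false = sum-tabulate (λ i → f (suc i))

  sum-by-classes : (G : ℕ → ℕ) → sum (λ a → G (size a)) ≡ sum (λ r → ⟦ isLeast r ⟧ * (G (size r) * size r))
  sum-by-classes G = begin
    sum (λ a → G (size a))
      ≡⟨ sum-cong-≗ (λ a → sym (trans (cong (G (size a) *_) (one-least a)) (*-identityʳ _))) ⟩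
    sum (λ a → G (size a) * sum (λ r → ⟦ isLeast r ⟧ * ⟦ E r a ⟧))
      ≡⟨ sum-cong-≗ (λ a → trans (*-distribˡ-sum (G (size a)) (λ r → ⟦ isLeast r ⟧ * ⟦ E r a ⟧))
                                  (sum-cong-≗ (move a))) ⟩
    sum (λ a → sum (λ r → ⟦ isLeast r ⟧ * (G (size r) * ⟦ E r a ⟧)))
      ≡⟨ ∑-comm {m} {m} (λ a r → ⟦ isLeast r ⟧ * (G (size r) * ⟦ E r a ⟧)) ⟩
    sum (λ r → sum (λ a → ⟦ isLeast r ⟧ * (G (size r) * ⟦ E r a ⟧)))
      ≡⟨ sum-cong-≗ (λ r → trans (sum-*ˡ ⟦ isLeast r ⟧ (λ a → G (size r) * ⟦ E r a ⟧))
                                  (cong (⟦ isLeast r ⟧ *_) (sum-*ˡ (G (size r)) (λ a → ⟦ E r a ⟧)))) ⟩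
    sum (λ r → ⟦ isLeast r ⟧ * (G (size r) * sum (λ a → ⟦ E r a ⟧)))
      ≡⟨ sum-cong-≗ (λ r → cong (λ z → ⟦ isLeast r ⟧ * (G (size r) * z)) (sym (countF-sum (E r)))) ⟩
    sum (λ r → ⟦ isLeast r ⟧ * (G (size r) * size r)) ∎
    where
    open ≡-Reasoning
    move : ∀ a r → G (size a) * (⟦ isLeast r ⟧ * ⟦ E r a ⟧) ≡ ⟦ isLeast r ⟧ * (G (size r) * ⟦ E r a ⟧)
    move a r with E r a in ra
    ... | true rewrite size-cong ra = *-exchange (G (size r)) ⟦ isLeast r ⟧ 1
    ... | false = trans (cong (G (size a) *_) (*-zeroʳ ⟦ isLeast r ⟧))
                        (trans (*-zeroʳ (G (size a))) (sym (trans (cong (⟦ isLeast r ⟧ *_) (*-zeroʳ (G (size r)))) (*-zeroʳ ⟦ isLeast r ⟧))))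

  count-by-classes : (P : ℕ → Bool) (K : ℕ) → (∀ a → P (size a) ≡ true → size a ≡ K) →
    sum (λ a → ⟦ P (size a) ⟧) ≡ K * List.sum (map (λ s → ⟦ P s ⟧) classSizes)
  count-by-classes P K pins = begin
    sum (λ a → ⟦ P (size a) ⟧)                              ≡⟨ sum-by-classes (λ s → ⟦ P s ⟧) ⟩
    sum (λ r → ⟦ isLeast r ⟧ * (⟦ P (size r) ⟧ * size r))   ≡⟨ sum-cong-≗ pull ⟩
    sum (λ r → K * (⟦ isLeast r ⟧ * ⟦ P (size r) ⟧))        ≡⟨ sum-*ˡ K (λ r → ⟦ isLeast r ⟧ * ⟦ P (size r) ⟧) ⟩
    K * sum (λ r → ⟦ isLeast r ⟧ * ⟦ P (size r) ⟧)          ≡⟨ cong (K *_) (sym (sum-classSizes (λ s → ⟦ P s ⟧))) ⟩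
    K * List.sum (map (λ s → ⟦ P s ⟧) classSizes)          ∎
    where
    open ≡-Reasoning
    weight : ∀ r → ⟦ P (size r) ⟧ * size r ≡ K * ⟦ P (size r) ⟧
    weight r with P (size r) in pr
    ... | true = trans (+-identityʳ (size r)) (trans (pins r pr) (sym (*-identityʳ K)))
    ... | false = sym (*-zeroʳ K)
    pull : ∀ r → ⟦ isLeast r ⟧ * (⟦ P (size r) ⟧ * size r) ≡ K * (⟦ isLeast r ⟧ * ⟦ P (size r) ⟧)
    pull r = trans (cong (⟦ isLeast r ⟧ *_) (weight r)) (*-exchange ⟦ isLeast r ⟧ K _)

-- The partner involution
-- partner swaps 2i and 2i+1 (0-based), so a and partner a are the two ends
-- of a straight edge of Γ_x (for odd k the last point is its own partner).

partner : ∀ {k} → Fin k → Fin k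
partner {suc zero} zero = zero
partner {suc (suc k)} zero = suc zero
partner {suc (suc k)} (suc zero) = zero
partner {suc (suc k)} (suc (suc i)) = suc (suc (partner i))

partner-involutive : ∀ {k} (a : Fin k) → partner (partner a) ≡ a
partner-involutive {suc zero} zero = refl
partner-involutive {suc (suc k)} zero = refl
partner-involutive {suc (suc k)} (suc zero) = refl
partner-involutive {suc (suc k)} (suc (suc i)) = cong (λ z → suc (suc z)) (partner-involutive i)

half-suc-suc : ∀ j → suc (suc j) / 2 ≡ suc (j / 2)
half-suc-suc j = m/n≡1+[m∸n]/n {suc (suc j)} {2} (s≤s (s≤s z≤n))

partner-half : ∀ {k} (a : Fin k) → toℕ (partner a) / 2 ≡ toℕ a / 2
partner-half {suc zero} zero = refl
partner-half {suc (suc k)} zero = refl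
partner-half {suc (suc k)} (suc zero) = refl
partner-half {suc (suc k)} (suc (suc i)) = trans (half-suc-suc (toℕ (partner i)))
  (trans (cong suc (partner-half i)) (sym (half-suc-suc (toℕ i))))

same-half : ∀ {k} (a b : Fin k) → toℕ a / 2 ≡ toℕ b / 2 → (a ≡ b → ⊥) → b ≡ partner a
same-half {suc zero} zero zero _ a≢b = ⊥-elim (a≢b refl)
same-half {suc (suc k)} zero zero _ a≢b = ⊥-elim (a≢b refl)
same-half {suc (suc k)} zero (suc zero) _ _ = refl
same-half {suc (suc k)} zero (suc (suc j)) e _ with trans e (half-suc-suc (toℕ j))
... | ()
same-half {suc (suc k)} (suc zero) zero _ _ = refl
same-half {suc (suc k)} (suc zero) (suc zero) _ a≢b = ⊥-elim (a≢b refl)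
same-half {suc (suc k)} (suc zero) (suc (suc j)) e _ with trans e (half-suc-suc (toℕ j))
... | ()
same-half {suc (suc k)} (suc (suc i)) zero e _ with trans (sym (half-suc-suc (toℕ i))) e
... | ()
same-half {suc (suc k)} (suc (suc i)) (suc zero) e _ with trans (sym (half-suc-suc (toℕ i))) e
... | ()
same-half {suc (suc k)} (suc (suc i)) (suc (suc j)) e a≢b =
  cong (λ z → suc (suc z)) (same-half i j halves (λ i≡j → a≢b (cong (λ z → suc (suc z)) i≡j)))
  where
  halves : toℕ i / 2 ≡ toℕ j / 2
  halves = suc-injective (trans (sym (half-suc-suc (toℕ i))) (trans e (half-suc-suc (toℕ j))))

-- Parity, to rule out a self-partnered point in Fin (2n).
odd : ℕ → Bool
odd zero = false
odd (suc zero) = true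
odd (suc (suc k)) = odd k

odd-double : ∀ n → odd (2 * n) ≡ false
odd-double n = subst (λ z → odd z ≡ false) (cong (n +_) (sym (+-identityʳ n))) (odd-self-sum n)
  where
  odd-self-sum : ∀ n → odd (n + n) ≡ false
  odd-self-sum zero = refl
  odd-self-sum (suc n) = subst (λ z → odd z ≡ false) (cong suc (sym (+-suc n n))) (odd-self-sum n)

partner-fixed⇒odd : ∀ {k} (a : Fin k) → partner a ≡ a → odd k ≡ true
partner-fixed⇒odd {suc zero} zero _ = refl
partner-fixed⇒odd {suc (suc k)} (suc (suc i)) e =
  partner-fixed⇒odd i (Fin-suc-injective (Fin-suc-injective e))

partner-≢ : ∀ n (a : Fin (2 * n)) → partner a ≡ a → ⊥
partner-≢ n a e = true≢false (partner-fixed⇒odd a e) (odd-double n)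

isFirst : ∀ {k} → Fin k → Bool
isFirst zero = true
isFirst (suc zero) = false
isFirst (suc (suc i)) = isFirst i

isFirst-partner : ∀ {k} (a : Fin k) → (partner a ≡ a → ⊥) → ⟦ isFirst a ⟧ + ⟦ isFirst (partner a) ⟧ ≡ 1
isFirst-partner {suc zero} zero ne = ⊥-elim (ne refl)
isFirst-partner {suc (suc k)} zero _ = refl
isFirst-partner {suc (suc k)} (suc zero) _ = refl
isFirst-partner {suc (suc k)} (suc (suc i)) ne = isFirst-partner i (λ e → ne (cong (λ z → suc (suc z)) e))

partner-closed-even : ∀ n (P : Fin (2 * n) → Bool) → (∀ a → P (partner a) ≡ P a) → ∃ λ h → countF P ≡ 2 * h
partner-closed-even n P closed =
  sum (λ a → ⟦ P a ⟧ * ⟦ isFirst a ⟧) ,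
  trans (countF-sum P) (sum-involution partner partner-involutive (λ a → ⟦ P a ⟧) (λ a → ⟦ P a ⟧ * ⟦ isFirst a ⟧) split)
  where
  split : ∀ a → ⟦ P a ⟧ ≡ ⟦ P a ⟧ * ⟦ isFirst a ⟧ + ⟦ P (partner a) ⟧ * ⟦ isFirst (partner a) ⟧
  split a = begin
    ⟦ P a ⟧                                                   ≡⟨ sym (*-identityʳ ⟦ P a ⟧) ⟩
    ⟦ P a ⟧ * 1                                               ≡⟨ cong (⟦ P a ⟧ *_) (sym (isFirst-partner a (partner-≢ n a))) ⟩
    ⟦ P a ⟧ * (⟦ isFirst a ⟧ + ⟦ isFirst (partner a) ⟧)       ≡⟨ *-distribˡ-+ ⟦ P a ⟧ ⟦ isFirst a ⟧ _ ⟩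
    ⟦ P a ⟧ * ⟦ isFirst a ⟧ + ⟦ P a ⟧ * ⟦ isFirst (partner a) ⟧ ≡⟨ cong (λ z → ⟦ P a ⟧ * ⟦ isFirst a ⟧ + ⟦ z ⟧ * _) (sym (closed a)) ⟩
    ⟦ P a ⟧ * ⟦ isFirst a ⟧ + ⟦ P (partner a) ⟧ * ⟦ isFirst (partner a) ⟧ ∎
    where open ≡-Reasoning

half-double : ∀ h → 2 * h / 2 ≡ h
half-double h = trans (cong (_/ 2) (*-comm 2 h)) (m*n/n≡m h 2)

wPart-component : ∀ h → 2 * wPart (2 * h / 2 ∸ 1) ≡ ⟦ 4 ≤ᵇ 2 * h ⟧ * (2 * h)
wPart-component h rewrite half-double h = by-half h
  where
  by-half : ∀ h → 2 * wPart (h ∸ 1) ≡ ⟦ 4 ≤ᵇ 2 * h ⟧ * (2 * h)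
  by-half zero = refl
  by-half (suc zero) = refl
  by-half (suc (suc k)) rewrite T⇒true (≤⇒≤ᵇ (*-monoʳ-≤ 2 (s≤s (s≤s (z≤n {k}))))) = sym (+-identityʳ _)

small-half : ∀ g → g < 4 → g / 2 ∸ 1 ≡ 0
small-half 0 _ = refl
small-half 1 _ = refl
small-half 2 _ = refl
small-half 3 _ = refl
small-half (suc (suc (suc (suc g)))) (s≤s (s≤s (s≤s (s≤s ()))))

pred-pins : ∀ s k → ((s ∸ 1) ≡ᵇ suc k) ≡ true → s ≡ suc (suc k)
pred-pins (suc s) k e = cong suc (≡ᵇ⇒≡ s (suc k) (true⇒T e))

half-pins : ∀ h k → ((2 * h / 2 ∸ 1) ≡ᵇ suc k) ≡ true → 2 * h ≡ 2 * suc (suc k)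
half-pins h k e = cong (2 *_) (pred-pins h k (subst (λ z → ((z ∸ 1) ≡ᵇ suc k) ≡ true) (half-double h) e))

hits-sum : ∀ u v k → u ≡ 0 ⊎ v ≡ 0 → ⟦ (u + v) ≡ᵇ suc k ⟧ ≡ ⟦ u ≡ᵇ suc k ⟧ + ⟦ v ≡ᵇ suc k ⟧
hits-sum .0 v k (inj₁ refl) = refl
hits-sum u .0 k (inj₂ refl) rewrite +-identityʳ u = sym (+-identityʳ _)

mult-map : ∀ k (f : ℕ → ℕ) l → mult k (map f l) ≡ List.sum (map (λ s → ⟦ f s ≡ᵇ k ⟧) l)
mult-map k f l = cong List.sum (sym (map-∘ l))

-- Orbits of a permutation

module Orbits (n : ℕ) (x : S2 n) where

  m : ℕ
  m = 2 * n

  ap : Fin m → Fin m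
  ap i = x ⟨$⟩ʳ i

  ap-injective : ∀ {a b} → ap a ≡ ap b → a ≡ b
  ap-injective {a} {b} e = trans (sym (inverseˡ x {a})) (trans (cong (x ⟨$⟩ˡ_) e) (inverseˡ x {b}))

  iter-+ : ∀ k j a → iter n x (k + j) a ≡ iter n x k (iter n x j a)
  iter-+ zero j a = refl
  iter-+ (suc k) j a = cong ap (iter-+ k j a)

  iter-injective : ∀ k {a b} → iter n x k a ≡ iter n x k b → a ≡ b
  iter-injective zero e = e
  iter-injective (suc k) e = iter-injective k (ap-injective e)

  period : ∀ a → Σ ℕ λ p → suc p ≤ m × iter n x (suc p) a ≡ a
  period a with pigeonhole (≤-refl {suc m}) (λ (j : Fin (suc m)) → iter n x (toℕ j) a)
  ... | i , j , i<j , e = d ∸ 1 , d≤m , returns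
    where
    d : ℕ
    d = toℕ j ∸ toℕ i
    d-pos : suc (d ∸ 1) ≡ d
    d-pos = trans (+-comm 1 (d ∸ 1)) (m∸n+n≡m (m<n⇒0<n∸m i<j))
    d≤m : suc (d ∸ 1) ≤ m
    d≤m = subst (_≤ m) (sym d-pos) (≤-trans (m∸n≤m (toℕ j) (toℕ i)) (≤-pred (toℕ<n j)))
    returns : iter n x (suc (d ∸ 1)) a ≡ a
    returns = subst (λ z → iter n x z a ≡ a) (sym d-pos) (iter-injective (toℕ i) (begin
      iter n x (toℕ i) (iter n x d a) ≡⟨ sym (iter-+ (toℕ i) d a) ⟩
      iter n x (toℕ i + d) a          ≡⟨ cong (λ z → iter n x z a) (m+[n∸m]≡n (<⇒≤ i<j)) ⟩
      iter n x (toℕ j) a              ≡⟨ sym e ⟩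
      iter n x (toℕ i) a              ∎))
      where open ≡-Reasoning

  iter-multiple : ∀ p {a} → iter n x p a ≡ a → ∀ q → iter n x (q * p) a ≡ a
  iter-multiple p e zero = refl
  iter-multiple p {a} e (suc q) = trans (iter-+ p (q * p) a) (trans (cong (iter n x p) (iter-multiple p e q)) e)

  Orbit : Fin m → Fin m → Set
  Orbit a b = Σ ℕ λ k → iter n x k a ≡ b

  -- Defs' bounded test inOrbit decides Orbit: reduce the exponent modulo the period.
  Orbit⇒inOrbit : ∀ {a b} → Orbit a b → inOrbit n x a b ≡ true
  Orbit⇒inOrbit {a} {b} (k , e) with period a
  ... | p , p≤m , returns =
    any⁺ (λ k → iter n x k a == b) (∈-upTo⁺ (<-≤-trans (m%n<n k (suc p)) p≤m)) (≡⇒== reduced)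
    where
    reduced : iter n x (k % suc p) a ≡ b
    reduced = begin
      iter n x (k % suc p) a                                    ≡⟨ cong (iter n x (k % suc p)) (sym (iter-multiple (suc p) returns (k / suc p))) ⟩
      iter n x (k % suc p) (iter n x (k / suc p * suc p) a)     ≡⟨ sym (iter-+ (k % suc p) (k / suc p * suc p) a) ⟩
      iter n x (k % suc p + k / suc p * suc p) a                ≡⟨ cong (λ z → iter n x z a) (sym (m≡m%n+[m/n]*n k (suc p))) ⟩
      iter n x k a                                              ≡⟨ e ⟩
      b                                                         ∎
      where open ≡-Reasoning

  inOrbit⇒Orbit : ∀ {a b} → inOrbit n x a b ≡ true → Orbit a b
  inOrbit⇒Orbit {a} {b} e with any⁻ (λ k → iter n x k a == b) (upTo m) e
  ... | k , hit = k , ==⇒≡ hit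

  Orbit-refl : ∀ a → Orbit a a
  Orbit-refl a = 0 , refl

  Orbit-trans : ∀ {a b c} → Orbit a b → Orbit b c → Orbit a c
  Orbit-trans {a} (k , refl) (j , refl) = j + k , iter-+ j k a

  Orbit-sym : ∀ {a b} → Orbit a b → Orbit b a
  Orbit-sym {a} (k , refl) with period a
  ... | p , _ , returns = k * suc p ∸ k , (begin
    iter n x (k * suc p ∸ k) (iter n x k a) ≡⟨ sym (iter-+ (k * suc p ∸ k) k a) ⟩
    iter n x (k * suc p ∸ k + k) a          ≡⟨ cong (λ z → iter n x z a) (m∸n+n≡m (m≤m*n k (suc p))) ⟩
    iter n x (k * suc p) a                  ≡⟨ iter-multiple (suc p) returns k ⟩
    a                                       ∎)
    where open ≡-Reasoning

  Orbit-ap : ∀ {a b} → Orbit a b → Orbit a (ap b)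
  Orbit-ap (k , e) = suc k , cong ap e

  Orbit-ap⁻ : ∀ {a b c} → ap c ≡ b → Orbit a b → Orbit a c
  Orbit-ap⁻ e ab = Orbit-trans ab (Orbit-sym (1 , e))

  inOrbit-refl : ∀ a → inOrbit n x a a ≡ true
  inOrbit-refl a = Orbit⇒inOrbit (Orbit-refl a)

  inOrbit-sym : ∀ {a b} → inOrbit n x a b ≡ true → inOrbit n x b a ≡ true
  inOrbit-sym e = Orbit⇒inOrbit (Orbit-sym (inOrbit⇒Orbit e))

  inOrbit-trans : ∀ {a b c} → inOrbit n x a b ≡ true → inOrbit n x b c ≡ true → inOrbit n x a c ≡ true
  inOrbit-trans e f = Orbit⇒inOrbit (Orbit-trans (inOrbit⇒Orbit e) (inOrbit⇒Orbit f))

  -- Cycles as classes: cycleLengths n x is Cycles.classSizes.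
  module Cycles = Classes (inOrbit n x) inOrbit-refl inOrbit-sym inOrbit-trans

  moved : Fin m → Bool
  moved a = not (ap a == a)

  fixed⇒¬moved : ∀ {a} → ap a ≡ a → moved a ≡ false
  fixed⇒¬moved e rewrite ≡⇒== e = refl

  ¬moved⇒fixed : ∀ {a} → moved a ≡ false → ap a ≡ a
  ¬moved⇒fixed {a} e with ap a == a in q
  ... | true = ==⇒≡ q

  moved⇒≢ : ∀ {a} → moved a ≡ true → ap a ≡ a → ⊥
  moved⇒≢ t e = true≢false t (fixed⇒¬moved e)

  iter-moved : ∀ {a} → moved a ≡ true → ∀ k → moved (iter n x k a) ≡ true
  iter-moved e zero = e
  iter-moved {a} e (suc k) with moved (ap (iter n x k a)) in q
  ... | true = refl
  ... | false = ⊥-elim (moved⇒≢ (iter-moved e k) (ap-injective (¬moved⇒fixed q)))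

  fixed-cycle : ∀ {a} → ap a ≡ a → Cycles.size a ≡ 1
  fixed-cycle {a} e = trans (countF-sum (inOrbit n x a)) (trans (sum-cong-≗ only-a) (sum-delta a))
    where
    iter-fixed : ∀ k → iter n x k a ≡ a
    iter-fixed zero = refl
    iter-fixed (suc k) = trans (cong ap (iter-fixed k)) e
    only-a : ∀ v → ⟦ inOrbit n x a v ⟧ ≡ ⟦ v == a ⟧
    only-a v = cong ⟦_⟧ (bool-ext (λ q → let (k , r) = inOrbit⇒Orbit q in ≡⇒== (trans (sym r) (iter-fixed k)))
                                  (λ q → Orbit⇒inOrbit (0 , sym (==⇒≡ q))))

-- Connectivity in Γ_x

module Connectivity (n : ℕ) (x : S2 n) where
  open Orbits n x public

  straight⇒partner : ∀ {a b} → straight n x a b ≡ true → b ≡ partner a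
  straight⇒partner {a} {b} e =
    same-half a b (≡ᵇ⇒≡ _ _ (true⇒T (∧-elimʳ {not (a == b)} e))) (λ q → true≢false (≡⇒== q) (not-true (∧-elimˡ e)))

  curved⇒partner : ∀ {a b} → curved n x a b ≡ true → ap b ≡ partner (ap a)
  curved⇒partner {a} {b} e =
    same-half (ap a) (ap b) (≡ᵇ⇒≡ _ _ (true⇒T (∧-elimʳ {not (a == b)} e)))
              (λ q → true≢false (≡⇒== (ap-injective q)) (not-true (∧-elimˡ e)))

  adj-straight : ∀ a → adj n x a (partner a) ≡ true
  adj-straight a = ∨-introˡ _ (∧-intro (cong not (≢⇒== (λ q → partner-≢ n a (sym q))))
                                      (T⇒true (≡⇒≡ᵇ _ _ (sym (partner-half a)))))

  adj-curved : ∀ {a b} → ap b ≡ partner (ap a) → adj n x a b ≡ true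
  adj-curved {a} {b} e = ∨-introʳ (straight n x a b) (∧-intro
    (cong not (≢⇒== {i = a} {b} (λ { refl → partner-≢ n (ap a) (sym e) })))
    (T⇒true (≡⇒≡ᵇ _ _ (sym (trans (cong (λ z → toℕ z / 2) e) (partner-half (ap a)))))))

  adj-cases : ∀ {a b} → adj n x a b ≡ true → b ≡ partner a ⊎ ap b ≡ partner (ap a)
  adj-cases {a} {b} e with ∨-elim {straight n x a b} e
  ... | inj₁ s = inj₁ (straight⇒partner s)
  ... | inj₂ c = inj₂ (curved⇒partner c)

  adj-sym : ∀ {a b} → adj n x a b ≡ true → adj n x b a ≡ true
  adj-sym {a} {b} e with adj-cases e
  ... | inj₁ q = subst (λ z → adj n x b z ≡ true) (trans (cong partner q) (partner-involutive a)) (adj-straight b)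
  ... | inj₂ q = adj-curved (trans (sym (partner-involutive (ap a))) (cong partner (sym q)))

  Reach : Fin m → Fin m → Set
  Reach a b = Σ ℕ λ t → reachIn n x t a b ≡ true

  reachIn-suc : ∀ t {a b} → reachIn n x t a b ≡ true → reachIn n x (suc t) a b ≡ true
  reachIn-suc t e = ∨-introˡ _ e

  reachIn-step : ∀ t {a c b} → reachIn n x t a c ≡ true → adj n x c b ≡ true → reachIn n x (suc t) a b ≡ true
  reachIn-step t {a} {c} {b} e f = ∨-introʳ (reachIn n x t a b) (anyF⁺ c (∧-intro e f))

  reachIn-inv : ∀ t {a b} → reachIn n x (suc t) a b ≡ true →
    reachIn n x t a b ≡ true ⊎ Σ (Fin m) λ c → reachIn n x t a c ≡ true × adj n x c b ≡ true
  reachIn-inv t {a} {b} e with ∨-elim {reachIn n x t a b} e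
  ... | inj₁ p = inj₁ p
  ... | inj₂ q with anyF⁻ q
  ... | c , r = inj₂ (c , ∧-elimˡ r , ∧-elimʳ {reachIn n x t a c} r)

  Reach-refl : ∀ a → Reach a a
  Reach-refl a = 0 , ≡⇒== {i = a} refl

  Reach-step : ∀ {a c b} → Reach a c → adj n x c b ≡ true → Reach a b
  Reach-step (t , e) f = suc t , reachIn-step t e f

  Reach-trans : ∀ {a b c} → Reach a b → Reach b c → Reach a c
  Reach-trans {a} ab (t , e) = extend t e
    where
    extend : ∀ t {c} → reachIn n x t _ c ≡ true → Reach a c
    extend zero e = subst (Reach a) (==⇒≡ e) ab
    extend (suc t) e with reachIn-inv t e
    ... | inj₁ p = extend t p
    ... | inj₂ (c , p , q) = Reach-step (extend t p) q

  Reach-sym : ∀ {a b} → Reach a b → Reach b a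
  Reach-sym (t , e) = reverse t e
    where
    reverse : ∀ t {a b} → reachIn n x t a b ≡ true → Reach b a
    reverse zero e = subst (λ z → Reach z _) (==⇒≡ e) (Reach-refl _)
    reverse (suc t) e with reachIn-inv t e
    ... | inj₁ p = reverse t p
    ... | inj₂ (c , p , q) = Reach-trans (Reach-step (Reach-refl _) (adj-sym {c} q)) (reverse t p)

  reachIn-closed : (Q : Fin m → Set) {a : Fin m} → Q a → (∀ {u v} → Q u → adj n x u v ≡ true → Q v) →
    ∀ t {v} → reachIn n x t a v ≡ true → Q v
  reachIn-closed Q qa closed zero e = subst Q (==⇒≡ e) qa
  reachIn-closed Q qa closed (suc t) e with reachIn-inv t e
  ... | inj₁ p = reachIn-closed Q qa closed t p
  ... | inj₂ (c , p , q) = closed (reachIn-closed Q qa closed t p) q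

  -- The sets B t = {b : reachIn t a b} increase with t; once B stops growing
  -- it is constant, and as it has at most m elements this happens by t = m.
  module _ (a : Fin m) where
    private
      B : ℕ → Fin m → Bool
      B t = reachIn n x t a

    Stable : ℕ → Set
    Stable t = ∀ s b → B (s + t) b ≡ true → B t b ≡ true

    stable-from-step : ∀ t → (∀ b → B (suc t) b ≡ true → B t b ≡ true) → Stable t
    stable-from-step t step zero b e = e
    stable-from-step t step (suc s) b e with reachIn-inv (s + t) e
    ... | inj₁ p = stable-from-step t step s b p
    ... | inj₂ (c , p , q) = step b (reachIn-step t (stable-from-step t step s c p) q)

    stable-suc : ∀ t → Stable t → Stable (suc t)
    stable-suc t st s b e = reachIn-suc t (st (suc s) b (subst (λ z → B z b ≡ true) (+-suc s t) e))

    grows-or-stable : ∀ t → suc t ≤ countF (B t) ⊎ Stable t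
    grows-or-stable zero = inj₁ (countF-pos (B 0) a (≡⇒== (refl {x = a})))
    grows-or-stable (suc t) with grows-or-stable t
    ... | inj₂ st = inj₂ (stable-suc t st)
    ... | inj₁ big with anyF (λ b → B (suc t) b ∧ not (B t b)) in new
    ... | true with anyF⁻ new
    ... | b , b-new = inj₁ (≤-trans (s≤s big) (countF-mono-< (reachIn-suc t) b (∧-elimˡ b-new)
                                                  (not-true (∧-elimʳ {B (suc t) b} b-new))))
    grows-or-stable (suc t) | inj₁ _ | false = inj₂ (stable-suc t (stable-from-step t no-new))
      where
      no-new : ∀ b → B (suc t) b ≡ true → B t b ≡ true
      no-new b e with bool-case (B t b)
      ... | inj₁ old = old
      ... | inj₂ fresh = ⊥-elim (true≢false (anyF⁺ {P = λ b → B (suc t) b ∧ not (B t b)} b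
                                  (subst (λ z → B (suc t) b ∧ not z ≡ true) (sym fresh) (∧-intro e refl))) new)

    stable-at-m : Stable m
    stable-at-m with grows-or-stable m
    ... | inj₂ st = st
    ... | inj₁ big = ⊥-elim (<⇒≱ big (countF≤ (B m)))

    reachIn-+ : ∀ d t {b} → B t b ≡ true → B (d + t) b ≡ true
    reachIn-+ zero t e = e
    reachIn-+ (suc d) t e = reachIn-suc (d + t) (reachIn-+ d t e)

    Reach⇒connected : ∀ {b} → Reach a b → connected n x a b ≡ true
    Reach⇒connected {b} (t , e) with ≤-total t m
    ... | inj₁ t≤m = subst (λ z → B z b ≡ true) (m∸n+n≡m t≤m) (reachIn-+ (m ∸ t) t e)
    ... | inj₂ m≤t = stable-at-m (t ∸ m) b (subst (λ z → B z b ≡ true) (sym (m∸n+n≡m m≤t)) e)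

  connected⇒Reach : ∀ {a b} → connected n x a b ≡ true → Reach a b
  connected⇒Reach e = m , e

  connected-refl : ∀ a → connected n x a a ≡ true
  connected-refl a = Reach⇒connected a (Reach-refl a)

  connected-sym : ∀ {a b} → connected n x a b ≡ true → connected n x b a ≡ true
  connected-sym {b = b} e = Reach⇒connected b (Reach-sym (connected⇒Reach e))

  connected-trans : ∀ {a b c} → connected n x a b ≡ true → connected n x b c ≡ true → connected n x a c ≡ true
  connected-trans {a} e f = Reach⇒connected a (Reach-trans (connected⇒Reach e) (connected⇒Reach f))

  connected-adj : ∀ {a b c} → connected n x a b ≡ true → adj n x b c ≡ true → connected n x a c ≡ true
  connected-adj {a} e f = Reach⇒connected a (Reach-step (connected⇒Reach e) f)

  -- Components as classes: componentSizes n x is Components.classSizes.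
  module Components = Classes (connected n x) connected-refl connected-sym connected-trans

  connected-partner : ∀ a b → connected n x a (partner b) ≡ connected n x a b
  connected-partner a b = bool-ext
    (λ e → subst (λ z → connected n x a z ≡ true) (partner-involutive b) (connected-adj e (adj-straight (partner b))))
    (λ e → connected-adj e (adj-straight b))

  component-even : ∀ a → ∃ λ h → Components.size a ≡ 2 * h
  component-even a = partner-closed-even n (connected n x a) (connected-partner a)

  size-partner : ∀ a → Components.size (partner a) ≡ Components.size a
  size-partner a = Components.size-cong (connected-adj (connected-refl a) (adj-straight a))

  fixed-pair-component : ∀ {a} → ap a ≡ a → ap (partner a) ≡ partner a → Components.size a ≤ 2
  fixed-pair-component {a} fa fpa = begin
    countF (connected n x a)                              ≡⟨ countF-sum (connected n x a) ⟩
    sum (λ v → ⟦ connected n x a v ⟧)                     ≤⟨ sum-mono in-pair ⟩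
    sum (λ v → ⟦ v == a ⟧ + ⟦ v == partner a ⟧)           ≡⟨ ∑-distrib-+ (λ v → ⟦ v == a ⟧) (λ v → ⟦ v == partner a ⟧) ⟩
    sum (λ v → ⟦ v == a ⟧) + sum (λ v → ⟦ v == partner a ⟧) ≡⟨ cong₂ _+_ (sum-delta a) (sum-delta (partner a)) ⟩
    2                                                     ∎
    where
    open ≤-Reasoning
    Pair : Fin m → Set
    Pair v = v ≡ a ⊎ v ≡ partner a
    Pair-partner : ∀ {v} → Pair v → Pair (partner v)
    Pair-partner (inj₁ refl) = inj₂ refl
    Pair-partner (inj₂ refl) = inj₁ (partner-involutive a)
    Pair-fixed : ∀ {v} → Pair v → ap v ≡ v
    Pair-fixed (inj₁ refl) = fa
    Pair-fixed (inj₂ refl) = fpa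
    closed : ∀ {u v} → Pair u → adj n x u v ≡ true → Pair v
    closed {u} {v} pu e with adj-cases e
    ... | inj₁ v≡pu = subst Pair (sym v≡pu) (Pair-partner pu)
    ... | inj₂ apv = subst Pair (sym (ap-injective (trans apv (trans (cong partner (Pair-fixed pu))
                                  (sym (Pair-fixed (Pair-partner pu))))))) (Pair-partner pu)
    in-pair : ∀ v → ⟦ connected n x a v ⟧ ≤ ⟦ v == a ⟧ + ⟦ v == partner a ⟧
    in-pair v with connected n x a v in av
    ... | false = z≤n
    ... | true with reachIn-closed Pair (inj₁ refl) closed m av
    ... | inj₁ refl rewrite ≡⇒== (refl {x = a}) = s≤s z≤n
    ... | inj₂ refl rewrite ≡⇒== (refl {x = partner a}) = m≤n+m 1 ⟦ partner a == a ⟧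

-- The tight case |S(x)| = w(μ_x)

module Tight (n : ℕ) (x : S2 n) (tight : supportSize n x ≡ w (stableCosetType n x)) where
  open Connectivity n x

  compSize : Fin m → ℕ
  compSize = Components.size

  cycleSize : Fin m → ℕ
  cycleSize = Cycles.size

  big : Fin m → Bool
  big a = 4 ≤ᵇ compSize a

  sum-big : sum (λ a → ⟦ big a ⟧) ≡ 2 * w (stableCosetType n x)
  sum-big = begin
    sum (λ a → ⟦ big a ⟧)
      ≡⟨ Components.sum-by-classes (λ s → ⟦ 4 ≤ᵇ s ⟧) ⟩
    sum (λ r → ⟦ isLeast r ⟧ * (⟦ big r ⟧ * compSize r))
      ≡⟨ sum-cong-≗ (λ r → cong (⟦ isLeast r ⟧ *_) (contribution r)) ⟩
    sum (λ r → ⟦ isLeast r ⟧ * (2 * wPart (compSize r / 2 ∸ 1)))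
      ≡⟨ sum-cong-≗ (λ r → *-exchange ⟦ isLeast r ⟧ 2 _) ⟩
    sum (λ r → 2 * (⟦ isLeast r ⟧ * wPart (compSize r / 2 ∸ 1)))
      ≡⟨ sum-*ˡ 2 (λ r → ⟦ isLeast r ⟧ * wPart (compSize r / 2 ∸ 1)) ⟩
    2 * sum (λ r → ⟦ isLeast r ⟧ * wPart (compSize r / 2 ∸ 1))
      ≡⟨ cong (2 *_) (sym (Components.sum-classSizes (λ s → wPart (s / 2 ∸ 1)))) ⟩
    2 * List.sum (map (λ s → wPart (s / 2 ∸ 1)) (componentSizes n x))
      ≡⟨ cong (λ l → 2 * List.sum l) (map-∘ (componentSizes n x)) ⟩
    2 * List.sum (map wPart (map (λ s → s / 2 ∸ 1) (componentSizes n x)))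
      ≡⟨ cong (2 *_) (sym (w-toPartition (map (λ s → s / 2 ∸ 1) (componentSizes n x)))) ⟩
    2 * w (stableCosetType n x) ∎
    where
    open ≡-Reasoning
    open Components using (isLeast)
    contribution : ∀ r → ⟦ big r ⟧ * compSize r ≡ 2 * wPart (compSize r / 2 ∸ 1)
    contribution r with component-even r
    ... | h , even rewrite even = sym (wPart-component h)

  big≤moved : ∀ a → ⟦ big a ⟧ ≤ ⟦ moved a ⟧ + ⟦ moved (partner a) ⟧
  big≤moved a with moved a in ma | moved (partner a) in mpa
  ... | true | _ = ≤-trans (⟦⟧≤1 (big a)) (s≤s z≤n)
  ... | false | true = ⟦⟧≤1 (big a)
  ... | false | false = ≤-reflexive (⟦false⟧ (≤ᵇ-false {4} {compSize a} (m≤n⇒m≤1+n (s≤s small))))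
    where
    small : compSize a ≤ 2
    small = fixed-pair-component (¬moved⇒fixed ma) (¬moved⇒fixed mpa)

  sum-moved-pairs : sum (λ a → ⟦ moved a ⟧ + ⟦ moved (partner a) ⟧) ≡ 2 * w (stableCosetType n x)
  sum-moved-pairs = trans (sum-involution partner partner-involutive _ (λ a → ⟦ moved a ⟧) (λ a → refl))
                          (cong (2 *_) (trans (sym (countF-sum moved)) tight))

  tight-at : ∀ a → ⟦ big a ⟧ ≡ ⟦ moved a ⟧ + ⟦ moved (partner a) ⟧
  tight-at = sum-≤-≡ big≤moved (trans sum-big (sym sum-moved-pairs))

  moved⇒partner-fixed : ∀ {a} → moved a ≡ true → ap (partner a) ≡ partner a
  moved⇒partner-fixed {a} ma with moved (partner a) in mpa
  ... | false = ¬moved⇒fixed mpa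
  ... | true = ⊥-elim (<⇒≱ (s≤s (s≤s z≤n)) (subst (_≤ 1) (trans (tight-at a) (cong₂ _+_ (⟦true⟧ ma) (⟦true⟧ mpa))) (⟦⟧≤1 (big a))))

  moved⇒big : ∀ {a} → moved a ≡ true → big a ≡ true
  moved⇒big {a} ma with big a in ba
  ... | true = refl
  ... | false = ⊥-elim (1+n≢0 (sym (trans (sym (⟦false⟧ ba)) (trans (tight-at a) (cong (_+ ⟦ moved (partner a) ⟧) (⟦true⟧ ma))))))

  big⇒one-moved : ∀ {a} → big a ≡ true → ⟦ moved a ⟧ + ⟦ moved (partner a) ⟧ ≡ 1
  big⇒one-moved {a} ba = trans (sym (tight-at a)) (⟦true⟧ ba)

  -- Step 3: for a moved point u, the path u — partner (x u) — x u shows that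
  -- cycles lie inside components.
  connected-ap : ∀ {u} → moved u ≡ true → connected n x u (ap u) ≡ true
  connected-ap {u} mu = subst (λ z → connected n x u z ≡ true) (partner-involutive (ap u))
    (connected-adj (connected-adj (connected-refl u) (adj-curved (moved⇒partner-fixed (iter-moved mu 1))))
                   (adj-straight (partner (ap u))))

  Orbit⇒connected : ∀ {a v} → moved a ≡ true → Orbit a v → connected n x a v ≡ true
  Orbit⇒connected {a} ma (zero , refl) = connected-refl a
  Orbit⇒connected {a} ma (suc k , refl) = connected-trans (Orbit⇒connected ma (k , refl)) (connected-ap (iter-moved ma k))

  Orbit-moved : ∀ {a v} → moved a ≡ true → Orbit a v → moved v ≡ true
  Orbit-moved ma (k , refl) = iter-moved ma k

  component⊆cycle : ∀ {a} → moved a ≡ true → ∀ {v} → connected n x a v ≡ true → Orbit a v ⊎ Orbit a (partner v)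
  component⊆cycle {a} ma = reachIn-closed Q (inj₁ (Orbit-refl a)) closed m
    where
    Q : Fin m → Set
    Q v = Orbit a v ⊎ Orbit a (partner v)
    Q-partner : ∀ {u} → Q u → Q (partner u)
    Q-partner {u} (inj₁ o) = inj₂ (subst (Orbit a) (sym (partner-involutive u)) o)
    Q-partner (inj₂ o) = inj₁ o
    closed : ∀ {u v} → Q u → adj n x u v ≡ true → Q v
    closed {u} {v} qu e with adj-cases e
    ... | inj₁ v≡pu = subst Q (sym v≡pu) (Q-partner qu)
    closed {u} {v} (inj₁ au) e | inj₂ apv = inj₂ (subst (Orbit a) (sym partner-v) (Orbit-ap au))
      where
      -- x u is moved, so its partner is fixed and is the curved neighbour v.
      partner-v : partner v ≡ ap u
      partner-v = trans (cong partner (ap-injective (trans apv (sym (moved⇒partner-fixed (iter-moved (Orbit-moved ma au) 1))))))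
                        (partner-involutive (ap u))
    closed {u} {v} (inj₂ apu) e | inj₂ apv = inj₁ (Orbit-ap⁻ (trans apv (cong partner u-fixed)) apu)
      where
      -- partner u is moved, so u is fixed and x v = partner u.
      u-fixed : ap u ≡ u
      u-fixed = subst (λ z → ap z ≡ z) (partner-involutive u) (moved⇒partner-fixed (Orbit-moved ma apu))

  inOrbit-component : ∀ {a} → moved a ≡ true → ∀ v → inOrbit n x a v ≡ connected n x a v ∧ moved v
  inOrbit-component {a} ma v = bool-ext
    (λ e → ∧-intro (Orbit⇒connected ma (inOrbit⇒Orbit e)) (Orbit-moved ma (inOrbit⇒Orbit e)))
    (λ e → Orbit⇒inOrbit (on-cycle (∧-elimˡ e) (∧-elimʳ {connected n x a v} e)))
    where
    on-cycle : connected n x a v ≡ true → moved v ≡ true → Orbit a v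
    on-cycle av mv with component⊆cycle ma av
    ... | inj₁ o = o
    ... | inj₂ o = ⊥-elim (moved⇒≢ mv (subst (λ z → ap z ≡ z) (partner-involutive v)
                                          (moved⇒partner-fixed (Orbit-moved ma o))))

  -- Every straight pair in that component has exactly one moved point, so
  -- the component has twice as many vertices as the cycle.
  component-of-moved : ∀ {a} → moved a ≡ true → compSize a ≡ 2 * cycleSize a
  component-of-moved {a} ma = begin
    countF (connected n x a)             ≡⟨ countF-sum (connected n x a) ⟩
    sum (λ v → ⟦ connected n x a v ⟧)    ≡⟨ sum-involution partner partner-involutive _ G split ⟩
    2 * sum G                            ≡⟨ cong (2 *_) (sum-cong-≗ (λ v → sym (trans (cong ⟦_⟧ (inOrbit-component ma v))
                                                                      (⟦∧⟧ (connected n x a v) (moved v))))) ⟩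
    2 * sum (λ v → ⟦ inOrbit n x a v ⟧) ≡⟨ cong (2 *_) (sym (countF-sum (inOrbit n x a))) ⟩
    2 * cycleSize a                      ∎
    where
    open ≡-Reasoning
    G : Fin m → ℕ
    G v = ⟦ connected n x a v ⟧ * ⟦ moved v ⟧
    split : ∀ v → ⟦ connected n x a v ⟧ ≡ G v + G (partner v)
    split v rewrite connected-partner a v with connected n x a v in av
    ... | false = refl
    ... | true = sym (trans (cong₂ _+_ (+-identityʳ ⟦ moved v ⟧) (+-identityʳ ⟦ moved (partner v) ⟧))
                            (big⇒one-moved (trans (cong (4 ≤ᵇ_) (Components.size-cong av)) (moved⇒big ma))))

  stable-component : ∀ a → compSize a / 2 ∸ 1 ≡ (cycleSize a ∸ 1) + (cycleSize (partner a) ∸ 1)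
  stable-component a with moved a in ma | moved (partner a) in mpa
  ... | true | _ rewrite component-of-moved ma | half-double (cycleSize a) | fixed-cycle (moved⇒partner-fixed ma) =
    sym (+-identityʳ _)
  ... | false | true rewrite sym (size-partner a) | component-of-moved mpa | half-double (cycleSize (partner a))
                           | fixed-cycle (¬moved⇒fixed ma) = refl
  ... | false | false rewrite fixed-cycle (¬moved⇒fixed ma) | fixed-cycle (¬moved⇒fixed mpa) = small-half (compSize a) small
    where
    small : compSize a < 4
    small = ≰⇒> (λ 4≤g → true≢false (T⇒true (≤⇒≤ᵇ 4≤g))
                   (⟦⟧-false (trans (tight-at a) (cong₂ _+_ (⟦false⟧ ma) (⟦false⟧ mpa)))))

  one-trivial : ∀ a → cycleSize a ∸ 1 ≡ 0 ⊎ cycleSize (partner a) ∸ 1 ≡ 0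
  one-trivial a with moved a in ma
  ... | true = inj₂ (cong (_∸ 1) (fixed-cycle (moved⇒partner-fixed ma)))
  ... | false = inj₁ (cong (_∸ 1) (fixed-cycle (¬moved⇒fixed ma)))

  -- Counted over vertices, each (k + 2)-cycle contributes k + 2 and each
  -- component of size 2(k + 2) contributes 2(k + 2); stable-component
  -- identifies the two vertex counts up to the factor 2.
  same-multiplicity : ∀ k → mult (suc k) (map (λ s → s ∸ 1) (cycleLengths n x))
                          ≡ mult (suc k) (map (λ s → s / 2 ∸ 1) (componentSizes n x))
  same-multiplicity k = begin
    mult (suc k) (map (λ s → s ∸ 1) (cycleLengths n x))          ≡⟨ mult-map (suc k) (λ s → s ∸ 1) (cycleLengths n x) ⟩
    cycles                                                      ≡⟨ *-cancelˡ-≡ cycles components (2 * K) double-count ⟩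
    components                                                  ≡⟨ sym (mult-map (suc k) (λ s → s / 2 ∸ 1) (componentSizes n x)) ⟩
    mult (suc k) (map (λ s → s / 2 ∸ 1) (componentSizes n x))   ∎
    where
    open ≡-Reasoning
    K : ℕ
    K = suc (suc k)
    onCycle : Fin m → ℕ
    onCycle a = ⟦ (cycleSize a ∸ 1) ≡ᵇ suc k ⟧
    cycles components : ℕ
    cycles = List.sum (map (λ s → ⟦ (s ∸ 1) ≡ᵇ suc k ⟧) (cycleLengths n x))
    components = List.sum (map (λ s → ⟦ (s / 2 ∸ 1) ≡ᵇ suc k ⟧) (componentSizes n x))
    cycle-count : sum onCycle ≡ K * cycles
    cycle-count = Cycles.count-by-classes (λ s → (s ∸ 1) ≡ᵇ suc k) K (λ a e → pred-pins (cycleSize a) k e)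
    component-count : sum (λ a → ⟦ (compSize a / 2 ∸ 1) ≡ᵇ suc k ⟧) ≡ (2 * K) * components
    component-count = Components.count-by-classes (λ s → (s / 2 ∸ 1) ≡ᵇ suc k) (2 * K) pins
      where
      pins : ∀ a → ((compSize a / 2 ∸ 1) ≡ᵇ suc k) ≡ true → compSize a ≡ 2 * K
      pins a e with component-even a
      ... | h , even rewrite even = half-pins h k e
    vertexwise : ∀ a → ⟦ (compSize a / 2 ∸ 1) ≡ᵇ suc k ⟧ ≡ onCycle a + onCycle (partner a)
    vertexwise a rewrite stable-component a = hits-sum _ _ k (one-trivial a)
    double-count : (2 * K) * cycles ≡ (2 * K) * components
    double-count = begin
      (2 * K) * cycles                                ≡⟨ *-assoc 2 K cycles ⟩
      2 * (K * cycles)                                ≡⟨ cong (2 *_) (sym cycle-count) ⟩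
      2 * sum onCycle                                 ≡⟨ sym (sum-involution partner partner-involutive _ onCycle vertexwise) ⟩
      sum (λ a → ⟦ (compSize a / 2 ∸ 1) ≡ᵇ suc k ⟧)    ≡⟨ component-count ⟩
      (2 * K) * components                            ∎

  cycleType≡cosetType : stableCycleType n x ≡ stableCosetType n x
  cycleType≡cosetType = toPartition-ext (map (λ s → s ∸ 1) (cycleLengths n x)) (map (λ s → s / 2 ∸ 1) (componentSizes n x)) same-multiplicity

-- Proposition 2.13.  Only |S(x)| = w(μ_x) is used: μ = μ_x by hypothesis.
proposition2p13 : (μ : List ℕ) → IsPartition μ → (n : ℕ) → (x : S2 n)
    → stableCosetType n x ≡ μ
    → supportSize n x ≡ w μ
    → stableCycleType n x ≡ stableCosetType n x
proposition2p13 μ _ n x coset≡μ support≡wμ =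
  Tight.cycleType≡cosetType n x (trans support≡wμ (cong w (sym coset≡μ)))
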